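{- Let $G$ be a connected graph and let $H$ be an isometric subgraph of $G$. If $X$ is a general position set of $G$, then $X\cap V(H)$ is a general position set of $H$. The same holds with "general position set" replaced throughout by "dual general position set", by "outer general position set", or by "total general position set".
   Context: All graphs are finite and simple. A subgraph $H$ of $G$ is isometric if $d_H(u,v)=d_G(u,v)$ for all $u,v\in V(H)$. For $X\subseteq V(G)$, two vertices $u,v$ are $X$-positionable if no shortest $u,v$-path in $G$ has an internal vertex in $X$ (in particular adjacent vertices are always $X$-positionable). Let $\overline X=V(G)\setminus X$. The set $X$ is: a general position set if every two vertices of $X$ are $X$-positionable; a total general position set if every two vertices of $V(G)$ are $X$-positionable; an outer general position set if every two vertices of $X$ are $X$-positionable and every $u\in X$, $v\in\overline X$ are $X$-positionable; a dual general position set if every two vertices of $X$ are $X$-positionable and every two vertices of $\overline X$ are $X$-positionable. -}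

module Defs where

open import Data.Nat using (ℕ; zero; suc; _≤_)
open import Data.Fin using (Fin)
open import Data.Product using (_×_; Σ; ∃)
open import Data.Sum using (_⊎_)
open import Data.Empty using (⊥)
open import Relation.Nullary using (¬_)
open import Relation.Binary.PropositionalEquality using (_≡_)
open import Function.Definitions using (Injective)

record Graph (n : ℕ) : Set₁ where
  field
    Adj   : Fin n → Fin n → Set
    sym   : ∀ {u v} → Adj u v → Adj v u
    irrefl : ∀ {u} → ¬ Adj u u
open Graph public

VSet : ℕ → Set₁
VSet n = Fin n → Set

module _ {n : ℕ} (G : Graph n) where

  data Walk : Fin n → Fin n → ℕ → Set where
    []  : ∀ {u} → Walk u u zero
    _∷_ : ∀ {u w v k} → Adj G u w → Walk w v k → Walk u v (suc k)

  IsDist : Fin n → Fin n → ℕ → Set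
  IsDist u v d = Walk u v d × (∀ k → Walk u v k → d ≤ k)

  Connected : Set
  Connected = ∀ u v → ∃ λ k → Walk u v k

  HitsInterior : ∀ {u v k} → Walk u v k → VSet n → Set
  HitsInterior [] X = ⊥
  HitsInterior (_∷_ e []) X = ⊥
  HitsInterior (_∷_ {w = w} e (e′ ∷ p)) X = X w ⊎ HitsInterior (e′ ∷ p) X

  Positionable : VSet n → Fin n → Fin n → Set
  Positionable X u v =
    ∀ d → IsDist u v d → (p : Walk u v d) → ¬ HitsInterior p X

  GeneralPosition : VSet n → Set
  GeneralPosition X = ∀ u v → X u → X v → Positionable X u v

  TotalGeneralPosition : VSet n → Set
  TotalGeneralPosition X = ∀ u v → Positionable X u v

  OuterGeneralPosition : VSet n → Set
  OuterGeneralPosition X =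
    GeneralPosition X × (∀ u v → X u → ¬ X v → Positionable X u v)

  DualGeneralPosition : VSet n → Set
  DualGeneralPosition X =
    GeneralPosition X × (∀ u v → ¬ X u → ¬ X v → Positionable X u v)

IsSubgraph : ∀ {m n} → Graph m → Graph n → (Fin m → Fin n) → Set
IsSubgraph H G f = Injective _≡_ _≡_ f × (∀ {a b} → Adj H a b → Adj G (f a) (f b))

IsIsometricSubgraph : ∀ {m n} → Graph m → Graph n → (Fin m → Fin n) → Set
IsIsometricSubgraph H G f =
  IsSubgraph H G f ×
  (∀ a b d → (IsDist H a b d → IsDist G (f a) (f b) d)
           × (IsDist G (f a) (f b) d → IsDist H a b d))

-- X ∩ V(H), as a vertex set of H.
restrict : ∀ {m n} → (Fin m → Fin n) → VSet n → VSet m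
restrict f X a = X (f a)

module Submission where

-- A shortest path of H is mapped by the embedding to a walk of G of the same
-- length, which is shortest in G because H is isometric, and it hits X in its
-- interior exactly where the original path hits X ∩ V(H). So every pair that
-- is X-positionable in G is (X ∩ V(H))-positionable in H, and each of the four
-- position properties, being a conjunction of positionability conditions on
-- classes of pairs, descends from G to H.

open import Defs
open import Data.Fin using (Fin)
open import Data.Product using (_×_; _,_; proj₁; proj₂)
open import Data.Sum using (inj₁; inj₂)

module _ {m n} {G : Graph n} {H : Graph m} {f : Fin m → Fin n}
         (hom : ∀ {a b} → Adj H a b → Adj G (f a) (f b)) where

  mapWalk : ∀ {a b k} → Walk H a b k → Walk G (f a) (f b) k
  mapWalk []      = []
  mapWalk (e ∷ p) = hom e ∷ mapWalk p

  mapWalk-hitsInterior : (X : VSet n) → ∀ {a b k} (p : Walk H a b k) →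
    HitsInterior H p (restrict f X) → HitsInterior G (mapWalk p) X
  mapWalk-hitsInterior X (e ∷ (e′ ∷ p)) (inj₁ x∈X) = inj₁ x∈X
  mapWalk-hitsInterior X (e ∷ (e′ ∷ p)) (inj₂ hit) =
    inj₂ (mapWalk-hitsInterior X (e′ ∷ p) hit)

  positionable-restrict :
    (∀ {a b d} → IsDist H a b d → IsDist G (f a) (f b) d) →
    (X : VSet n) → ∀ {a b} →
    Positionable G X (f a) (f b) → Positionable H (restrict f X) a b
  positionable-restrict dist-pres X pos d dist p hit =
    pos d (dist-pres dist) (mapWalk p) (mapWalk-hitsInterior X p hit)

module _ {m n} {G : Graph n} {H : Graph m} {f : Fin m → Fin n}
         (iso : IsIsometricSubgraph H G f) (X : VSet n) where

  private
    pull : ∀ {a b} →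
      Positionable G X (f a) (f b) → Positionable H (restrict f X) a b
    pull = positionable-restrict (proj₂ (proj₁ iso))
             (λ {a} {b} {d} → proj₁ (proj₂ iso a b d)) X

  generalPosition-restrict :
    GeneralPosition G X → GeneralPosition H (restrict f X)
  generalPosition-restrict gp a b a∈X b∈X = pull (gp (f a) (f b) a∈X b∈X)

  dualGeneralPosition-restrict :
    DualGeneralPosition G X → DualGeneralPosition H (restrict f X)
  dualGeneralPosition-restrict (gp , outside) =
    generalPosition-restrict gp ,
    λ a b a∉X b∉X → pull (outside (f a) (f b) a∉X b∉X)

  outerGeneralPosition-restrict :
    OuterGeneralPosition G X → OuterGeneralPosition H (restrict f X)
  outerGeneralPosition-restrict (gp , across) =
    generalPosition-restrict gp ,
    λ a b a∈X b∉X → pull (across (f a) (f b) a∈X b∉X)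

  totalGeneralPosition-restrict :
    TotalGeneralPosition G X → TotalGeneralPosition H (restrict f X)
  totalGeneralPosition-restrict tgp a b = pull (tgp (f a) (f b))

lemma3p1 : ∀ {m n} (G : Graph n) (H : Graph m) (f : Fin m → Fin n) →
    Connected G → IsIsometricSubgraph H G f → (X : VSet n) →
    (GeneralPosition G X → GeneralPosition H (restrict f X)) ×
    (DualGeneralPosition G X → DualGeneralPosition H (restrict f X)) ×
    (OuterGeneralPosition G X → OuterGeneralPosition H (restrict f X)) ×
    (TotalGeneralPosition G X → TotalGeneralPosition H (restrict f X))
lemma3p1 G H f _ iso X =
  generalPosition-restrict iso X ,
  dualGeneralPosition-restrict iso X ,
  outerGeneralPosition-restrict iso X ,
  totalGeneralPosition-restrict iso X
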